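{- A bijective function $f:L\to M$ between o-algebras is an isomorphism in $\mathbf{OA}$ if and only if it is an order-isomorphism. In that case $f^\dagger=f^{ -1}$.
   Context: Work in intuitionistic logic without choice. A positivity predicate on a complete lattice $L$ is a unary predicate $\mathrm{Pos}$ such that: (i) $\mathrm{Pos}(x)$ and $x\le y$ imply $\mathrm{Pos}(y)$; (ii) $\mathrm{Pos}(\bigvee X)$ implies $\mathrm{Pos}(x)$ for some $x\in X$; (iii) if $\mathrm{Pos}(x)\Rightarrow x\le y$, then $x\le y$. An o-algebra is a frame $L$ with a positivity predicate such that for all $x,y$: if $\mathrm{Pos}(z\wedge x)\Rightarrow\mathrm{Pos}(z\wedge y)$ for every $z\in L$, then $x\le y$. Write $x\bowtie y$ (overlap) for $\mathrm{Pos}(x\wedge y)$. Functions $f:L\to M$, $g:M\to L$ are symmetric if $f(x)\bowtie y\iff x\bowtie g(y)$; $f$ is symmetrizable if it has a (unique) symmetric $f^\dagger$. $\mathbf{OA}$ is the category of o-algebras and symmetrizable functions. -}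

module Defs where

open import Level using (Level; suc; _⊔_)
open import Data.Product using (Σ; ∃; _×_; _,_)
open import Relation.Binary.PropositionalEquality using (_≡_)
open import Function.Bundles using (_⇔_)
open import Function.Definitions using (Bijective)

Subset : ∀ {ℓ} → Set ℓ → Set (suc ℓ)
Subset {ℓ} A = A → Set ℓ

record OAlgebra (ℓ : Level) : Set (suc ℓ) where
  infix 4 _≤_
  infixr 7 _∧_
  field
    Carrier : Set ℓ
    _≤_ : Carrier → Carrier → Set ℓ
    ≤-refl : ∀ x → x ≤ x
    ≤-trans : ∀ {x y z} → x ≤ y → y ≤ z → x ≤ z
    ≤-antisym : ∀ {x y} → x ≤ y → y ≤ x → x ≡ y
    ⋁ : Subset Carrier → Carrier
    ⋁-upper : ∀ (X : Subset Carrier) x → X x → x ≤ ⋁ X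
    ⋁-least : ∀ (X : Subset Carrier) y → (∀ x → X x → x ≤ y) → ⋁ X ≤ y
    _∧_ : Carrier → Carrier → Carrier
    ∧-lower₁ : ∀ x y → x ∧ y ≤ x
    ∧-lower₂ : ∀ x y → x ∧ y ≤ y
    ∧-greatest : ∀ {x y z} → z ≤ x → z ≤ y → z ≤ x ∧ y
    ∧-distrib-⋁ : ∀ x (X : Subset Carrier) →
      x ∧ ⋁ X ≡ ⋁ (λ z → Σ Carrier (λ y → X y × (z ≡ x ∧ y)))
    Pos : Carrier → Set ℓ
    Pos-mono : ∀ {x y} → Pos x → x ≤ y → Pos y
    Pos-⋁ : ∀ (X : Subset Carrier) → Pos (⋁ X) → Σ Carrier (λ x → X x × Pos x)
    Pos-pos : ∀ {x y} → (Pos x → x ≤ y) → x ≤ y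
    oalg : ∀ {x y} → (∀ z → Pos (z ∧ x) → Pos (z ∧ y)) → x ≤ y

  _⋈_ : Carrier → Carrier → Set ℓ
  x ⋈ y = Pos (x ∧ y)

open OAlgebra

module _ {ℓ : Level} (L M : OAlgebra ℓ) where

  Symmetric : (Carrier L → Carrier M) → (Carrier M → Carrier L) → Set ℓ
  Symmetric f g = ∀ x y → (_⋈_ M (f x) y ⇔ _⋈_ L x (g y))

  Symmetrizable : (Carrier L → Carrier M) → Set ℓ
  Symmetrizable f = Σ (Carrier M → Carrier L) (λ g → Symmetric f g)

  OrderIso : (Carrier L → Carrier M) → Set ℓ
  OrderIso f = ∀ x y → (_≤_ L x y ⇔ _≤_ M (f x) (f y))

  IsBijective : (Carrier L → Carrier M) → Set ℓ
  IsBijective f = Bijective _≡_ _≡_ f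

IsoOA : ∀ {ℓ} (L M : OAlgebra ℓ) → (Carrier L → Carrier M) → Set ℓ
IsoOA L M f = Σ (Carrier M → Carrier L) (λ g →
  Symmetrizable L M f × Symmetrizable M L g ×
  (∀ x → g (f x) ≡ x) × (∀ y → f (g y) ≡ y))

module Submission where

-- The key observation is that an order embedding f (x ≤ y ⇔ f x ≤ f y)
-- preserves positivity: by axiom (iii) Pos x forces x ≤ ⋁{x | Pos (f x)},
-- and axiom (ii) then yields Pos (f x).  A monotone positivity-preserving
-- map preserves overlap, so two mutually inverse order isomorphisms are
-- symmetric to each other.  Conversely, symmetrizable maps are monotone
-- (via the o-algebra axiom), so the inverse of an OA-isomorphism is
-- monotone and f reflects the order.  Finally, the o-algebra axiom makes
-- the symmetric partner of a map unique, which identifies f† with f⁻¹.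

open import Defs
open import Level using (Level)
open import Data.Product using (Σ; _×_; _,_; proj₁; proj₂)
open import Relation.Binary.PropositionalEquality using (_≡_; refl; sym; trans; cong)
open import Function.Bundles using (_⇔_; mk⇔; Equivalence)

open OAlgebra
open Equivalence using (to; from)

module _ {ℓ : Level} where

  ≤-reflexive : (L : OAlgebra ℓ) → ∀ {x y} → x ≡ y → _≤_ L x y
  ≤-reflexive L {x} refl = ≤-refl L x

  ⋈-comm : (L : OAlgebra ℓ) → ∀ {x y} → _⋈_ L x y → _⋈_ L y x
  ⋈-comm L {x} {y} p = Pos-mono L p (∧-greatest L (∧-lower₂ L x y) (∧-lower₁ L x y))

  ∧-mono : (L : OAlgebra ℓ) → ∀ {x x′ y y′} →
           _≤_ L x x′ → _≤_ L y y′ → _≤_ L (_∧_ L x y) (_∧_ L x′ y′)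
  ∧-mono L x≤x′ y≤y′ =
    ∧-greatest L (≤-trans L (∧-lower₁ L _ _) x≤x′) (≤-trans L (∧-lower₂ L _ _) y≤y′)

  Monotone : (L M : OAlgebra ℓ) → (Carrier L → Carrier M) → Set ℓ
  Monotone L M f = ∀ {x y} → _≤_ L x y → _≤_ M (f x) (f y)

  -- Every symmetrizable map is monotone: if x ≤ y then any z overlapping
  -- f x overlaps f y, and the o-algebra axiom gives f x ≤ f y.
  symmetrizable⇒monotone : (L M : OAlgebra ℓ) (f : Carrier L → Carrier M) →
                           Symmetrizable L M f → Monotone L M f
  symmetrizable⇒monotone L M f (f† , f-sym) {x} {y} x≤y = oalg M overlap-transfer
    where
      overlap-transfer : ∀ z → _⋈_ M z (f x) → _⋈_ M z (f y)
      overlap-transfer z z⋈fx =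
        ⋈-comm M (from (f-sym y z)
          (Pos-mono L (to (f-sym x z) (⋈-comm M z⋈fx))
                      (∧-mono L x≤y (≤-refl L (f† z)))))

  -- With S = {x | Pos (f x)},
  -- axiom (iii) in M shows f x ≤ f (⋁ S), hence x ≤ ⋁ S; so ⋁ S is
  -- positive, and axiom (ii) produces a positive member, i.e. Pos (f x).
  orderEmbedding⇒Pos : (L M : OAlgebra ℓ) (f : Carrier L → Carrier M) →
                       OrderIso L M f → ∀ {x} → Pos L x → Pos M (f x)
  orderEmbedding⇒Pos L M f f-emb {x} pos-x = proj₂ (proj₁ (proj₂ witness))
    where
      S : Subset (Carrier L)
      S w = (w ≡ x) × Pos M (f x)

      x≤⋁S : _≤_ L x (⋁ L S)
      x≤⋁S = from (f-emb x (⋁ L S)) (Pos-pos M λ pos-fx →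
               to (f-emb x (⋁ L S)) (⋁-upper L S x (refl , pos-fx)))

      witness : Σ (Carrier L) λ w → S w × Pos L w
      witness = Pos-⋁ L S (Pos-mono L pos-x x≤⋁S)

  ⋈-preserved : (L M : OAlgebra ℓ) (h : Carrier L → Carrier M) →
                Monotone L M h → (∀ {x} → Pos L x → Pos M (h x)) →
                ∀ {x y} → _⋈_ L x y → _⋈_ M (h x) (h y)
  ⋈-preserved L M h h-mono h-pos x⋈y =
    Pos-mono M (h-pos x⋈y) (∧-greatest M (h-mono (∧-lower₁ L _ _)) (h-mono (∧-lower₂ L _ _)))

  retraction-reflects : (L M : OAlgebra ℓ) (f : Carrier L → Carrier M) (g : Carrier M → Carrier L) →
                        (∀ x → g (f x) ≡ x) → Monotone M L g →
                        ∀ {x y} → _≤_ M (f x) (f y) → _≤_ L x y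
  retraction-reflects L M f g gf g-mono {x} {y} fx≤fy =
    ≤-trans L (≤-reflexive L (sym (gf x))) (≤-trans L (g-mono fx≤fy) (≤-reflexive L (gf y)))

  inverse-OrderIso : (L M : OAlgebra ℓ) (f : Carrier L → Carrier M) (g : Carrier M → Carrier L) →
                     (∀ y → f (g y) ≡ y) → OrderIso L M f → OrderIso M L g
  inverse-OrderIso L M f g fg f-iso x y = mk⇔
    (λ x≤y → from (f-iso (g x) (g y)) (≤-trans M (≤-reflexive M (fg x))
                                        (≤-trans M x≤y (≤-reflexive M (sym (fg y))))))
    (retraction-reflects M L g f fg (λ {a} {b} → to (f-iso a b)))

  -- Mutually inverse order isomorphisms are symmetric: both preserve
  -- overlap, and applying the inverse undoes f on the left-hand argument.
  inverseOrderIsos-symmetric : (L M : OAlgebra ℓ) (f : Carrier L → Carrier M) (g : Carrier M → Carrier L) →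
                               (∀ x → g (f x) ≡ x) → (∀ y → f (g y) ≡ y) →
                               OrderIso L M f → Symmetric L M f g
  inverseOrderIsos-symmetric L M f g gf fg f-iso x y = mk⇔
    (λ fx⋈y → Pos-mono L (⋈-preserved M L g g-mono (orderEmbedding⇒Pos M L g g-iso) fx⋈y)
                         (∧-mono L (≤-reflexive L (gf x)) (≤-refl L (g y))))
    (λ x⋈gy → Pos-mono M (⋈-preserved L M f f-mono (orderEmbedding⇒Pos L M f f-iso) x⋈gy)
                         (∧-mono M (≤-refl M (f x)) (≤-reflexive M (fg y))))
    where
      g-iso : OrderIso M L g
      g-iso = inverse-OrderIso L M f g fg f-iso

      f-mono : Monotone L M f
      f-mono {a} {b} = to (f-iso a b)

      g-mono : Monotone M L g
      g-mono {a} {b} = to (g-iso a b)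

  -- The symmetric partner of a map is unique: if h and k are both
  -- symmetric to f, then z ⋈ h y ⇔ f z ⋈ y ⇔ z ⋈ k y for every z.
  symmetric-unique : (L M : OAlgebra ℓ) (f : Carrier L → Carrier M) (h k : Carrier M → Carrier L) →
                     Symmetric L M f h → Symmetric L M f k → ∀ y → h y ≡ k y
  symmetric-unique L M f h k h-sym k-sym y = ≤-antisym L (below h k h-sym k-sym) (below k h k-sym h-sym)
    where
      below : (h k : Carrier M → Carrier L) → Symmetric L M f h → Symmetric L M f k →
              _≤_ L (h y) (k y)
      below h k h-sym k-sym = oalg L λ z z⋈hy → to (k-sym z y) (from (h-sym z y) z⋈hy)

  bijection-inverse : (L M : OAlgebra ℓ) (f : Carrier L → Carrier M) → IsBijective L M f →
                      Σ (Carrier M → Carrier L) λ g → (∀ x → g (f x) ≡ x) × (∀ y → f (g y) ≡ y)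
  bijection-inverse L M f (f-inj , f-surj) = g , gf , fg
    where
      g : Carrier M → Carrier L
      g y = proj₁ (f-surj y)

      fg : ∀ y → f (g y) ≡ y
      fg y = proj₂ (f-surj y) refl

      gf : ∀ x → g (f x) ≡ x
      gf x = f-inj (fg (f x))

proposition4p2 : ∀ {ℓ : Level} (L M : OAlgebra ℓ) (f : OAlgebra.Carrier L → OAlgebra.Carrier M) →
    IsBijective L M f →
    (IsoOA L M f ⇔ OrderIso L M f) ×
    (IsoOA L M f → ∀ (g : OAlgebra.Carrier M → OAlgebra.Carrier L) → Symmetric L M f g →
      (∀ y → f (g y) ≡ y) × (∀ x → g (f x) ≡ x))
proposition4p2 L M f f-bij = mk⇔ iso⇒orderIso orderIso⇒iso , dagger-is-inverse
  where
    -- f is monotone as a symmetrizable map, and reflects the order because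
    -- its inverse is symmetrizable, hence monotone.
    iso⇒orderIso : IsoOA L M f → OrderIso L M f
    iso⇒orderIso (g , f-symz , g-symz , gf , fg) x y =
      mk⇔ (symmetrizable⇒monotone L M f f-symz)
          (retraction-reflects L M f g gf (symmetrizable⇒monotone M L g g-symz))

    orderIso⇒iso : OrderIso L M f → IsoOA L M f
    orderIso⇒iso f-iso with bijection-inverse L M f f-bij
    ... | g , gf , fg =
      g , (g , inverseOrderIsos-symmetric L M f g gf fg f-iso)
        , (f , inverseOrderIsos-symmetric M L g f fg gf (inverse-OrderIso L M f g fg f-iso))
        , gf , fg

    dagger-is-inverse : IsoOA L M f → ∀ g′ → Symmetric L M f g′ →
                        (∀ y → f (g′ y) ≡ y) × (∀ x → g′ (f x) ≡ x)
    dagger-is-inverse (g , f-symz , g-symz , gf , fg) g′ g′-sym =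
      (λ y → trans (cong f (g′≡g y)) (fg y)) , (λ x → trans (g′≡g (f x)) (gf x))
      where
        g-sym : Symmetric L M f g
        g-sym = inverseOrderIsos-symmetric L M f g gf fg (iso⇒orderIso (g , f-symz , g-symz , gf , fg))

        g′≡g : ∀ y → g′ y ≡ g y
        g′≡g = symmetric-unique L M f g′ g g′-sym g-sym
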